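{- For all positive integers $r$ and $t$, the graph $T_r\boxtimes P_t$ admits a $(4,\sqsubseteq_1)$-tame $S$-shaped representation, where $S$ is the set of boxes in $\mathbb{R}^3$.
   Context: $T_r$ is the star with $r+1$ vertices, $P_t$ is the path with $t$ vertices, and $\boxtimes$ is the strong product of graphs. A box in $\mathbb{R}^3$ is a product of $3$ closed intervals. A shape is a compact set not contained in any proper affine subspace. An $S$-shaped intersection representation of $G$ assigns to each vertex $v$ a translation $\varphi(v)$ of an element of $S$ such that for distinct $u,v$, $\varphi(u)\cap\varphi(v)\neq\emptyset$ iff $uv\in E(G)$; it is $c$-thin if each point lies in at most $c$ sets $\varphi(v)$. $B_1\sqsubseteq_sB_2$ means: for every $x\in B_2$ there is a translation $B_1'$ of $B_1$ with $x\in B_1'$ and $\mathrm{vol}(B_1'\cap B_2)\ge\frac1s\mathrm{vol}(B_1)$; $\sqsubseteq_s$-comparable means $B_1\sqsubseteq_sB_2$ or $B_2\sqsubseteq_sB_1$. A representation is $(c,\sqsubseteq_s)$-tame if it is $c$-thin, each $\varphi(v)$ is a convex shape, and all pairs $\varphi(u),\varphi(v)$ are $\sqsubseteq_s$-comparable.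
   Formalization: Points, boxes, translations and volumes are taken over ℚ³ in place of $\mathbb{R}^3$. -}

module Defs where

open import Data.Nat using (ℕ; suc)
open import Data.Fin using (Fin; zero; suc; toℕ)
open import Data.Product using (Σ; ∃; _×_; _,_)
open import Data.Sum using (_⊎_)
open import Relation.Nullary using (¬_)
open import Relation.Binary.PropositionalEquality using (_≡_; _≢_)
open import Function.Definitions using (Injective)
open import Data.Rational using (ℚ; 0ℚ; 1ℚ; _+_; _-_; _*_; _≤_; _<_; _⊔_; _⊓_)

-- Graphs (simple graphs given by a symmetric irreflexive adjacency)

record Graph : Set₁ where
  field
    V   : Set
    Adj : V → V → Set

open Graph public

StarAdj : (r : ℕ) → Fin (suc r) → Fin (suc r) → Set
StarAdj r i j = i ≢ j × (i ≡ zero ⊎ j ≡ zero)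

PathAdj : (t : ℕ) → Fin t → Fin t → Set
PathAdj t i j = suc (toℕ i) ≡ toℕ j ⊎ suc (toℕ j) ≡ toℕ i

_⊠_ : Graph → Graph → Graph
G ⊠ H = record
  { V   = V G × V H
  ; Adj = λ { (u , x) (v , y) →
        ¬ ((u ≡ v) × (x ≡ y)) × (u ≡ v ⊎ Adj G u v) × (x ≡ y ⊎ Adj H x y) } }

T : ℕ → Graph
T r = record { V = Fin (suc r) ; Adj = StarAdj r }

P : ℕ → Graph
P t = record { V = Fin t ; Adj = PathAdj t }

Point : Set
Point = Fin 3 → ℚ

record Box : Set where
  field
    lo hi : Point
    lo≤hi : ∀ i → lo i ≤ hi i
open Box public

_∈B_ : Point → Box → Set
x ∈B B = ∀ i → (lo B i ≤ x i) × (x i ≤ hi B i)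

translate : Box → Point → Box
translate B w = record
  { lo = λ i → lo B i + w i ; hi = λ i → hi B i + w i
  ; lo≤hi = λ i → Data.Rational.Properties.+-monoˡ-≤ (w i) (lo≤hi B i) }
  where import Data.Rational.Properties

prod3 : (Fin 3 → ℚ) → ℚ
prod3 f = f zero * f (suc zero) * f (suc (suc zero))

vol : Box → ℚ
vol B = prod3 (λ i → hi B i - lo B i)

volCap : Box → Box → ℚ
volCap A B = prod3 (λ i → 0ℚ ⊔ ((hi A i ⊓ hi B i) - (lo A i ⊔ lo B i)))

_⊑[_]_ : Box → ℚ → Box → Set
B₁ ⊑[ s ] B₂ = ∀ x → x ∈B B₂ → ∃ λ w →
  (x ∈B translate B₁ w) × (vol B₁ ≤ s * volCap (translate B₁ w) B₂)

Comparable : ℚ → Box → Box → Set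
Comparable s A B = A ⊑[ s ] B ⊎ B ⊑[ s ] A

dot : Point → Point → ℚ
dot c x = prod3Sum
  where prod3Sum = c zero * x zero + c (suc zero) * x (suc zero)
                   + c (suc (suc zero)) * x (suc (suc zero))

Convex : Box → Set
Convex B = ∀ x y (λ' : ℚ) → x ∈B B → y ∈B B → 0ℚ ≤ λ' → λ' ≤ 1ℚ →
  (λ i → λ' * x i + (1ℚ - λ') * y i) ∈B B

-- Shape: compact (automatic for boxes) and not contained in any proper
-- affine subspace, i.e. not contained in any affine hyperplane c·x = d, c ≠ 0
Shape : Box → Set
Shape B = ¬ (Σ Point λ c → Σ ℚ λ d → (¬ (∀ i → c i ≡ 0ℚ)) ×
                (∀ x → x ∈B B → dot c x ≡ d))

-- every φ v is a box, i.e. a translate of an element of S = all boxes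
IsRep : (G : Graph) → (V G → Box) → Set
IsRep G φ = ∀ u v → u ≢ v →
  ((∃ λ x → x ∈B φ u × x ∈B φ v) → Adj G u v) × (Adj G u v → ∃ λ x → x ∈B φ u × x ∈B φ v)

Thin : (G : Graph) → ℕ → (V G → Box) → Set
Thin G c φ = ∀ (x : Point) (f : Fin (suc c) → V G) → Injective _≡_ _≡_ f →
  ¬ (∀ k → x ∈B φ (f k))

Tame : (G : Graph) → ℕ → ℚ → (V G → Box) → Set
Tame G c s φ = Thin G c φ × (∀ v → Convex (φ v) × Shape (φ v)) ×
  (∀ u v → Comparable s (φ u) (φ v))

HasTameBoxRep : Graph → ℕ → ℚ → Set
HasTameBoxRep G c s = Σ (V G → Box) λ φ → IsRep G φ × Tame G c s φ

-- The copy of the star vertex u in layer j of the path is the box C × [0,1] × [j, j+1], where the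
-- column C is [0, 2(r+1)] for the centre u = 0 and [2u, 2u+1] for a leaf. Two boxes meet iff their
-- columns and their layers overlap, which is adjacency-or-equality in the strong product. A point
-- lies in at most two consecutive layers and, within a layer, in the centre and at most one leaf,
-- so colouring by (centre or leaf, parity of j) separates the boxes through a point: 4-thin.
-- All boxes have sides (w, 1, 1), so around any point of the larger one a translate of the
-- smaller one fits inside it, which gives ⊑₁-comparability.
module Submission where

open import Defs
open import Data.Nat as ℕ using (ℕ; zero; suc; z≤n; s≤s)
import Data.Nat.Properties as ℕ
open import Data.Fin as Fin using (Fin; zero; suc; toℕ; combine)
import Data.Fin.Properties as Fin
open import Data.Vec.Functional using (updateAt; _∷_; [])
open import Data.Vec.Functional.Properties using (updateAt-updates; updateAt-minimal)
open import Data.Parity using (Parity; 0ℙ; 1ℙ)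
open import Data.Parity.Properties using (p≢p⁻¹; suc-homo-⁻¹)
open import Data.Product using (∃; _×_; _,_; proj₁; proj₂)
open import Data.Sum using (_⊎_; inj₁; inj₂; map₁)
open import Function using (_∘_)
open import Relation.Nullary using (yes; no; contradiction)
open import Relation.Binary.PropositionalEquality
open import Data.Rational using (ℚ; 0ℚ; 1ℚ; _+_; _-_; _*_; -_; _⊔_; _≤_; _<_; positive; nonNegative)
open import Data.Rational.Properties
open import Data.Rational.Solver using (module +-*-Solver)
open +-*-Solver using (solve; _:+_; _:-_; _:*_; _:=_; con)

private
  variable
    p q : ℚ
    m n : ℕ

p≤q⇒0≤q-p : p ≤ q → 0ℚ ≤ q - p
p≤q⇒0≤q-p {p} {q} p≤q = subst (_≤ q - p) (+-inverseʳ p) (+-monoˡ-≤ (- p) p≤q)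

p<q⇒0<q-p : p < q → 0ℚ < q - p
p<q⇒0<q-p {p} {q} p<q = subst (_< q - p) (+-inverseʳ p) (+-monoˡ-< (- p) p<q)

p<1+p : ∀ p → p < 1ℚ + p
p<1+p p = subst (_< 1ℚ + p) (+-identityˡ p) (+-monoˡ-< p (positive⁻¹ 1ℚ))

p*q≡0⇒p≡0 : 0ℚ < q → p * q ≡ 0ℚ → p ≡ 0ℚ
p*q≡0⇒p≡0 {q} 0<q pq≡0 = ≤-antisym
  (*-cancelʳ-≤-pos q (≤-reflexive (trans pq≡0 (sym (*-zeroˡ q)))))
  (*-cancelʳ-≤-pos q (≤-reflexive (trans (*-zeroˡ q) (sym pq≡0))))
  where instance _ = positive 0<q

ι : ℕ → ℚ
ι zero    = 0ℚ
ι (suc n) = 1ℚ + ι n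

ι-mono-≤ : m ℕ.≤ n → ι m ≤ ι n
ι-mono-≤ {n = zero}  z≤n       = ≤-refl
ι-mono-≤ {n = suc n} z≤n       = ≤-trans (ι-mono-≤ {n = n} z≤n) (<⇒≤ (p<1+p (ι n)))
ι-mono-≤             (s≤s m≤n) = +-monoʳ-≤ 1ℚ (ι-mono-≤ m≤n)

ι-mono-< : m ℕ.< n → ι m < ι n
ι-mono-< {m} (s≤s m≤n) = <-≤-trans (p<1+p (ι m)) (+-monoʳ-≤ 1ℚ (ι-mono-≤ m≤n))

ι-cancel-≤ : ι m ≤ ι n → m ℕ.≤ n
ι-cancel-≤ ιm≤ιn = ℕ.≮⇒≥ (λ n<m → <-irrefl refl (<-≤-trans (ι-mono-< n<m) ιm≤ιn))

ι-homo-+ : ∀ m n → ι (m ℕ.+ n) ≡ ι m + ι n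
ι-homo-+ zero    n = sym (+-identityˡ (ι n))
ι-homo-+ (suc m) n = trans (cong (1ℚ +_) (ι-homo-+ m n)) (sym (+-assoc 1ℚ (ι m) (ι n)))

ι[m+n]-ι[m]≡ι[n] : ∀ m n → ι (m ℕ.+ n) - ι m ≡ ι n
ι[m+n]-ι[m]≡ι[n] m n = trans (cong (_- ι m) (ι-homo-+ m n))
  (solve 2 (λ x y → (x :+ y) :- x := y) refl (ι m) (ι n))

convex-combination-mono-≤ : ∀ {λ′ a b x y} → 0ℚ ≤ λ′ → λ′ ≤ 1ℚ → a ≤ x → b ≤ y →
  λ′ * a + (1ℚ - λ′) * b ≤ λ′ * x + (1ℚ - λ′) * y
convex-combination-mono-≤ {λ′} 0≤λ λ≤1 a≤x b≤y = +-mono-≤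
  (*-monoˡ-≤-nonNeg λ′ {{nonNegative 0≤λ}} a≤x)
  (*-monoˡ-≤-nonNeg (1ℚ - λ′) {{nonNegative (p≤q⇒0≤q-p λ≤1)}} b≤y)

convex-combination-idem : ∀ λ′ a → λ′ * a + (1ℚ - λ′) * a ≡ a
convex-combination-idem = solve 2 (λ l a → l :* a :+ (con 1ℚ :- l) :* a := a) refl

box-convex : ∀ B → Convex B
box-convex B x y λ′ x∈B y∈B 0≤λ λ≤1 i =
  subst (_≤ _) (convex-combination-idem λ′ (lo B i))
    (convex-combination-mono-≤ 0≤λ λ≤1 (proj₁ (x∈B i)) (proj₁ (y∈B i))) ,
  subst (_ ≤_) (convex-combination-idem λ′ (hi B i))
    (convex-combination-mono-≤ 0≤λ λ≤1 (proj₂ (x∈B i)) (proj₂ (y∈B i)))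

dot-updateAt : ∀ c x i q → dot c (updateAt x i (λ _ → q)) - dot c x ≡ c i * (q - x i)
dot-updateAt c x zero q =
  solve 7 (λ a b c q x y z → (a :* q :+ b :* y :+ c :* z) :- (a :* x :+ b :* y :+ c :* z) := a :* (q :- x))
    refl (c zero) (c (suc zero)) (c (suc (suc zero))) q (x zero) (x (suc zero)) (x (suc (suc zero)))
dot-updateAt c x (suc zero) q =
  solve 7 (λ a b c q x y z → (a :* x :+ b :* q :+ c :* z) :- (a :* x :+ b :* y :+ c :* z) := b :* (q :- y))
    refl (c zero) (c (suc zero)) (c (suc (suc zero))) q (x zero) (x (suc zero)) (x (suc (suc zero)))
dot-updateAt c x (suc (suc zero)) q =
  solve 7 (λ a b c q x y z → (a :* x :+ b :* y :+ c :* q) :- (a :* x :+ b :* y :+ c :* z) := c :* (q :- z))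
    refl (c zero) (c (suc zero)) (c (suc (suc zero))) q (x zero) (x (suc zero)) (x (suc (suc zero)))

box-shape : ∀ B → (∀ i → lo B i < hi B i) → Shape B
box-shape B lo<hi (c , d , c≢0 , onPlane) = c≢0 coefficient≡0
  where
  edge : Fin 3 → Point
  edge i = updateAt (lo B) i (λ _ → hi B i)

  lo∈B : lo B ∈B B
  lo∈B i = ≤-refl , lo≤hi B i

  edge∈B : ∀ i → edge i ∈B B
  edge∈B i j with i Fin.≟ j
  ... | yes refl = subst (λ y → lo B i ≤ y × y ≤ hi B i)
                     (sym (updateAt-updates i (lo B))) (lo≤hi B i , ≤-refl)
  ... | no i≢j   = subst (λ y → lo B j ≤ y × y ≤ hi B j)
                     (sym (updateAt-minimal j i (lo B) (i≢j ∘ sym))) (lo∈B j)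

  coefficient≡0 : ∀ i → c i ≡ 0ℚ
  coefficient≡0 i = p*q≡0⇒p≡0 (p<q⇒0<q-p (lo<hi i)) (begin
    c i * (hi B i - lo B i)        ≡⟨ sym (dot-updateAt c (lo B) i (hi B i)) ⟩
    dot c (edge i) - dot c (lo B)  ≡⟨ cong₂ _-_ (onPlane _ (edge∈B i)) (onPlane _ lo∈B) ⟩
    d - d                          ≡⟨ +-inverseʳ d ⟩
    0ℚ                             ∎)
    where open ≡-Reasoning

_⊆B_ : Box → Box → Set
A ⊆B B = ∀ i → lo B i ≤ lo A i × hi A i ≤ hi B i

prod3-cong : ∀ {f g : Fin 3 → ℚ} → (∀ i → f i ≡ g i) → prod3 f ≡ prod3 g
prod3-cong f≗g = cong₂ _*_ (cong₂ _*_ (f≗g zero) (f≗g (suc zero))) (f≗g (suc (suc zero)))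

volCap-⊆ : ∀ {A B} → A ⊆B B → volCap A B ≡ vol A
volCap-⊆ {A} A⊆B = prod3-cong λ i → trans
  (cong₂ (λ h l → 0ℚ ⊔ (h - l)) (p≤q⇒p⊓q≡p (proj₂ (A⊆B i))) (p≥q⇒p⊔q≡p (proj₁ (A⊆B i))))
  (p≤q⇒p⊔q≡q (p≤q⇒0≤q-p (lo≤hi A i)))

vol-translate : ∀ A w → vol (translate A w) ≡ vol A
vol-translate A w = prod3-cong λ i →
  solve 3 (λ h l w → (h :+ w) :- (l :+ w) := h :- l) refl (hi A i) (lo A i) (w i)

interval-start-fit : ∀ {a l h x} → 0ℚ ≤ a → a ≤ h - l → l ≤ x → x ≤ h →
  ∃ λ m → (m ≤ x × x ≤ m + a) × (l ≤ m × m + a ≤ h)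
interval-start-fit {a} {l} {h} {x} 0≤a a≤h-l l≤x x≤h with ≤-total (x + a) h
... | inj₁ x+a≤h = x ,
  (≤-refl , subst (_≤ x + a) (+-identityʳ x) (+-monoʳ-≤ x 0≤a)) ,
  (l≤x , x+a≤h)
... | inj₂ h≤x+a = h - a ,
  (subst (h - a ≤_) (h+a-a≡h x a) (+-monoˡ-≤ (- a) h≤x+a) , subst (x ≤_) (sym (h-a+a≡h h a)) x≤h) ,
  (subst (_≤ h - a) (h-[h-l]≡l h l) (+-monoʳ-≤ h (neg-antimono-≤ a≤h-l)) ,
   ≤-reflexive (h-a+a≡h h a))
  where
  h+a-a≡h : ∀ h a → (h + a) - a ≡ h
  h+a-a≡h = solve 2 (λ h a → (h :+ a) :- a := h) refl
  h-a+a≡h : ∀ h a → (h - a) + a ≡ h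
  h-a+a≡h = solve 2 (λ h a → (h :- a) :+ a := h) refl
  h-[h-l]≡l : ∀ h l → h - (h - l) ≡ l
  h-[h-l]≡l = solve 2 (λ h l → h :- (h :- l) := l) refl

interval-translate-fit : ∀ {lA hA l h x} → lA ≤ hA → hA - lA ≤ h - l → l ≤ x → x ≤ h →
  ∃ λ w → (lA + w ≤ x × x ≤ hA + w) × (l ≤ lA + w × hA + w ≤ h)
interval-translate-fit {lA} {hA} lA≤hA sides≤ l≤x x≤h
  with interval-start-fit (p≤q⇒0≤q-p lA≤hA) sides≤ l≤x x≤h
... | m , (m≤x , x≤m+a) , (l≤m , m+a≤h) = m - lA ,
  (subst (_≤ _) (sym lo≡m) m≤x , subst (_ ≤_) (sym hi≡m+a) x≤m+a) ,
  (subst (_ ≤_) (sym lo≡m) l≤m , subst (_≤ _) (sym hi≡m+a) m+a≤h)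
  where
  lo≡m : lA + (m - lA) ≡ m
  lo≡m = solve 2 (λ l m → l :+ (m :- l) := m) refl lA m
  hi≡m+a : hA + (m - lA) ≡ m + (hA - lA)
  hi≡m+a = solve 3 (λ h l m → h :+ (m :- l) := m :+ (h :- l)) refl hA lA m

sides≤⇒⊑₁ : ∀ {A B} → (∀ i → hi A i - lo A i ≤ hi B i - lo B i) → A ⊑[ 1ℚ ] B
sides≤⇒⊑₁ {A} {B} sides≤ x x∈B = w , x∈A+w , ≤-reflexive (sym (begin
  1ℚ * volCap (translate A w) B  ≡⟨ *-identityˡ _ ⟩
  volCap (translate A w) B       ≡⟨ volCap-⊆ {translate A w} {B} A+w⊆B ⟩
  vol (translate A w)            ≡⟨ vol-translate A w ⟩
  vol A                          ∎))
  where
  open ≡-Reasoning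
  fit : ∀ i → ∃ λ wᵢ → (lo A i + wᵢ ≤ x i × x i ≤ hi A i + wᵢ) ×
                       (lo B i ≤ lo A i + wᵢ × hi A i + wᵢ ≤ hi B i)
  fit i = interval-translate-fit (lo≤hi A i) (sides≤ i) (proj₁ (x∈B i)) (proj₂ (x∈B i))
  w : Point
  w i = proj₁ (fit i)
  x∈A+w : x ∈B translate A w
  x∈A+w i = proj₁ (proj₂ (fit i))
  A+w⊆B : translate A w ⊆B B
  A+w⊆B i = proj₂ (proj₂ (fit i))

ℕBox : (corner side : Fin 3 → ℕ) → Box
ℕBox a m = record
  { lo    = λ i → ι (a i)
  ; hi    = λ i → ι (a i ℕ.+ m i)
  ; lo≤hi = λ i → ι-mono-≤ (ℕ.m≤m+n (a i) (m i))
  }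

Overlap : (a m b n : ℕ) → Set
Overlap a m b n = a ℕ.≤ b ℕ.+ n × b ℕ.≤ a ℕ.+ m

overlap-refl : ∀ a m → Overlap a m a m
overlap-refl a m = ℕ.m≤m+n a m , ℕ.m≤m+n a m

overlap-sym : ∀ {a m b n} → Overlap a m b n → Overlap b n a m
overlap-sym (a≤b+n , b≤a+m) = b≤a+m , a≤b+n

module _ (a m b n : Fin 3 → ℕ) where

  ℕBox-meet⇒overlap : ∀ {x} → x ∈B ℕBox a m → x ∈B ℕBox b n →
    ∀ i → Overlap (a i) (m i) (b i) (n i)
  ℕBox-meet⇒overlap x∈A x∈B i =
    ι-cancel-≤ (≤-trans (proj₁ (x∈A i)) (proj₂ (x∈B i))) ,
    ι-cancel-≤ (≤-trans (proj₁ (x∈B i)) (proj₂ (x∈A i)))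

  overlap⇒ℕBox-meet : (∀ i → Overlap (a i) (m i) (b i) (n i)) →
    ∃ λ x → x ∈B ℕBox a m × x ∈B ℕBox b n
  overlap⇒ℕBox-meet overlaps = (λ i → ι (a i ℕ.⊔ b i)) , x∈A , x∈B
    where
    x∈A : _ ∈B ℕBox a m
    x∈A i = ι-mono-≤ (ℕ.m≤m⊔n (a i) (b i)) ,
            ι-mono-≤ (ℕ.⊔-lub (ℕ.m≤m+n (a i) (m i)) (proj₂ (overlaps i)))
    x∈B : _ ∈B ℕBox b n
    x∈B i = ι-mono-≤ (ℕ.m≤n⊔m (a i) (b i)) ,
            ι-mono-≤ (ℕ.⊔-lub (proj₁ (overlaps i)) (ℕ.m≤m+n (b i) (n i)))

  ℕBox-⊑₁ : (∀ i → m i ℕ.≤ n i) → ℕBox a m ⊑[ 1ℚ ] ℕBox b n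
  ℕBox-⊑₁ m≤n = sides≤⇒⊑₁ {ℕBox a m} {ℕBox b n} λ i →
    subst₂ _≤_ (sym (ι[m+n]-ι[m]≡ι[n] (a i) (m i))) (sym (ι[m+n]-ι[m]≡ι[n] (b i) (n i)))
      (ι-mono-≤ (m≤n i))

ℕBox-shape : ∀ a m → (∀ i → 0 ℕ.< m i) → Shape (ℕBox a m)
ℕBox-shape a m 0<m = box-shape (ℕBox a m) λ i → ι-mono-< (ℕ.m<m+n (a i) (0<m i))

thin-by-colouring : ∀ G c {φ} (κ : V G → Fin c) →
  (∀ x a b → x ∈B φ a → x ∈B φ b → κ a ≡ κ b → a ≡ b) → Thin G c φ
thin-by-colouring G c κ separates x f f-injective x∈φf
  with Fin.pigeonhole (ℕ.n<1+n c) (κ ∘ f)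
... | i , k , i<k , κfi≡κfk =
  Fin.<⇒≢ i<k (f-injective (separates x (f i) (f k) (x∈φf i) (x∈φf k) κfi≡κfk))

unit-overlap : ∀ {a b} → a ≡ b ⊎ (suc a ≡ b ⊎ suc b ≡ a) → Overlap a 1 b 1
unit-overlap {a}     (inj₁ refl)        = overlap-refl a 1
unit-overlap {a}     (inj₂ (inj₁ refl)) = ℕ.m≤n⇒m≤1+n (ℕ.m≤m+n a 1) , ℕ.≤-reflexive (ℕ.+-comm 1 a)
unit-overlap {b = b} (inj₂ (inj₂ refl)) = overlap-sym (unit-overlap {b} (inj₂ (inj₁ refl)))

overlap⇒unit-close : ∀ a b → Overlap a 1 b 1 → a ≡ b ⊎ (suc a ≡ b ⊎ suc b ≡ a)
overlap⇒unit-close zero          zero          _                 = inj₁ refl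
overlap⇒unit-close zero          (suc zero)    _                 = inj₂ (inj₁ refl)
overlap⇒unit-close (suc zero)    zero          _                 = inj₂ (inj₂ refl)
overlap⇒unit-close zero          (suc (suc b)) (_ , s≤s ())
overlap⇒unit-close (suc (suc a)) zero          (s≤s () , _)
overlap⇒unit-close (suc a)       (suc b)       (s≤s p , s≤s q)
  with overlap⇒unit-close a b (p , q)
... | inj₁ a≡b        = inj₁ (cong suc a≡b)
... | inj₂ (inj₁ a≡b) = inj₂ (inj₁ (cong suc a≡b))
... | inj₂ (inj₂ b≡a) = inj₂ (inj₂ (cong suc b≡a))

path-overlap : ∀ {t} {j j′ : Fin t} → j ≡ j′ ⊎ PathAdj t j j′ → Overlap (toℕ j) 1 (toℕ j′) 1
path-overlap = unit-overlap ∘ map₁ (cong toℕ)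

overlap⇒path : ∀ {t} {j j′ : Fin t} → Overlap (toℕ j) 1 (toℕ j′) 1 → j ≡ j′ ⊎ PathAdj t j j′
overlap⇒path {j = j} {j′} = map₁ Fin.toℕ-injective ∘ overlap⇒unit-close (toℕ j) (toℕ j′)

parity[1+n]≢parity[n] : ∀ n → ℕ.parity (suc n) ≢ ℕ.parity n
parity[1+n]≢parity[n] n eq = p≢p⁻¹ (ℕ.parity (suc n)) (trans eq (sym (suc-homo-⁻¹ n)))

same-parity-overlap⇒≡ : ∀ {a b} → ℕ.parity a ≡ ℕ.parity b → Overlap a 1 b 1 → a ≡ b
same-parity-overlap⇒≡ {a} {b} same overlaps with overlap⇒unit-close a b overlaps
... | inj₁ a≡b         = a≡b
... | inj₂ (inj₁ refl) = contradiction (sym same) (parity[1+n]≢parity[n] a)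
... | inj₂ (inj₂ refl) = contradiction same (parity[1+n]≢parity[n] b)

parityIndex : Parity → Fin 2
parityIndex 0ℙ = zero
parityIndex 1ℙ = suc zero

parityIndex-injective : ∀ {p q} → parityIndex p ≡ parityIndex q → p ≡ q
parityIndex-injective {0ℙ} {0ℙ} _ = refl
parityIndex-injective {1ℙ} {1ℙ} _ = refl
parityIndex-injective {0ℙ} {1ℙ} ()
parityIndex-injective {1ℙ} {0ℙ} ()

double-cancel-≤ : ∀ m n → m ℕ.* 2 ℕ.≤ n ℕ.* 2 ℕ.+ 1 → m ℕ.≤ n
double-cancel-≤ zero    n       _                 = z≤n
double-cancel-≤ (suc m) zero    (s≤s ())
double-cancel-≤ (suc m) (suc n) (s≤s (s≤s 2m≤2n+1)) = s≤s (double-cancel-≤ m n 2m≤2n+1)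

module StarPathBoxes (r t : ℕ) where

  G : Graph
  G = T (suc r) ⊠ P (suc t)

  column : Fin (suc (suc r)) → ℕ
  column u = toℕ u ℕ.* 2

  width : Fin (suc (suc r)) → ℕ
  width zero    = suc r ℕ.* 2
  width (suc _) = 1

  corner : V G → Fin 3 → ℕ
  corner (u , j) = column u ∷ 0 ∷ toℕ j ∷ []

  side : V G → Fin 3 → ℕ
  side (u , _) = width u ∷ 1 ∷ 1 ∷ []

  φ : V G → Box
  φ v = ℕBox (corner v) (side v)

  ColumnsOverlap : Fin (suc (suc r)) → Fin (suc (suc r)) → Set
  ColumnsOverlap u v = Overlap (column u) (width u) (column v) (width v)

  LayersOverlap : Fin (suc t) → Fin (suc t) → Set
  LayersOverlap j j′ = Overlap (toℕ j) 1 (toℕ j′) 1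

  φ-meet⇒overlap : ∀ {x} u j v j′ → x ∈B φ (u , j) → x ∈B φ (v , j′) →
    ColumnsOverlap u v × LayersOverlap j j′
  φ-meet⇒overlap u j v j′ x∈φa x∈φb = overlaps zero , overlaps (suc (suc zero))
    where
    overlaps : ∀ i → Overlap (corner (u , j) i) (side (u , j) i) (corner (v , j′) i) (side (v , j′) i)
    overlaps = ℕBox-meet⇒overlap (corner (u , j)) (side (u , j)) (corner (v , j′)) (side (v , j′))
                 x∈φa x∈φb

  overlap⇒φ-meet : ∀ u j v j′ → ColumnsOverlap u v → LayersOverlap j j′ →
    ∃ λ x → x ∈B φ (u , j) × x ∈B φ (v , j′)
  overlap⇒φ-meet u j v j′ columns layers =
    overlap⇒ℕBox-meet (corner (u , j)) (side (u , j)) (corner (v , j′)) (side (v , j′)) λ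
      { zero             → columns
      ; (suc zero)       → overlap-refl 0 1
      ; (suc (suc zero)) → layers
      }

  centre-overlaps : ∀ v → ColumnsOverlap zero v
  centre-overlaps v = z≤n , ℕ.*-monoˡ-≤ 2 (Fin.toℕ≤pred[n] v)

  star-overlap : ∀ {u v} → u ≡ v ⊎ StarAdj (suc r) u v → ColumnsOverlap u v
  star-overlap {u}     (inj₁ refl)             = overlap-refl (column u) (width u)
  star-overlap {v = v} (inj₂ (_ , inj₁ refl)) = centre-overlaps v
  star-overlap {u}     (inj₂ (_ , inj₂ refl)) = overlap-sym (centre-overlaps u)

  leaves-overlap⇒≡ : ∀ {k l} → ColumnsOverlap (suc k) (suc l) → suc k ≡ suc l
  leaves-overlap⇒≡ {k} {l} (p , q) = Fin.toℕ-injective (ℕ.≤-antisym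
    (double-cancel-≤ (suc (toℕ k)) (suc (toℕ l)) p)
    (double-cancel-≤ (suc (toℕ l)) (suc (toℕ k)) q))

  overlap⇒star : ∀ u v → ColumnsOverlap u v → u ≡ v ⊎ StarAdj (suc r) u v
  overlap⇒star zero    zero    _        = inj₁ refl
  overlap⇒star zero    (suc _) _        = inj₂ ((λ ()) , inj₁ refl)
  overlap⇒star (suc _) zero    _        = inj₂ ((λ ()) , inj₂ refl)
  overlap⇒star (suc _) (suc _) overlaps = inj₁ (leaves-overlap⇒≡ overlaps)

  φ-represents : IsRep G φ
  φ-represents (u , j) (v , j′) uj≢vj′ = meet⇒adjacent , adjacent⇒meet
    where
    meet⇒adjacent : (∃ λ x → x ∈B φ (u , j) × x ∈B φ (v , j′)) → Adj G (u , j) (v , j′)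
    meet⇒adjacent (x , x∈φa , x∈φb) with φ-meet⇒overlap u j v j′ x∈φa x∈φb
    ... | columns , layers =
      (λ (u≡v , j≡j′) → uj≢vj′ (cong₂ _,_ u≡v j≡j′)) , overlap⇒star u v columns , overlap⇒path layers
    adjacent⇒meet : Adj G (u , j) (v , j′) → ∃ λ x → x ∈B φ (u , j) × x ∈B φ (v , j′)
    adjacent⇒meet (_ , star , path) = overlap⇒φ-meet u j v j′ (star-overlap star) (path-overlap path)

  role : Fin (suc (suc r)) → Fin 2
  role zero    = zero
  role (suc _) = suc zero

  same-role-overlap⇒≡ : ∀ u v → role u ≡ role v → ColumnsOverlap u v → u ≡ v
  same-role-overlap⇒≡ zero    zero    _  _        = refl
  same-role-overlap⇒≡ (suc _) (suc _) _  overlaps = leaves-overlap⇒≡ overlaps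
  same-role-overlap⇒≡ zero    (suc _) () _
  same-role-overlap⇒≡ (suc _) zero    () _

  colour : V G → Fin 4
  colour (u , j) = combine (role u) (parityIndex (ℕ.parity (toℕ j)))

  colour-separates : ∀ x a b → x ∈B φ a → x ∈B φ b → colour a ≡ colour b → a ≡ b
  colour-separates _ (u , j) (v , j′) x∈φa x∈φb same-colour
    with φ-meet⇒overlap u j v j′ x∈φa x∈φb | Fin.combine-injective (role u) _ (role v) _ same-colour
  ... | columns , layers | same-role , same-parity = cong₂ _,_
    (same-role-overlap⇒≡ u v same-role columns)
    (Fin.toℕ-injective (same-parity-overlap⇒≡ (parityIndex-injective same-parity) layers))

  side-positive : ∀ v i → 0 ℕ.< side v i
  side-positive (zero , _)  zero             = s≤s z≤n
  side-positive (suc _ , _) zero             = s≤s z≤n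
  side-positive _           (suc zero)       = s≤s z≤n
  side-positive _           (suc (suc zero)) = s≤s z≤n

  side-mono : ∀ a b → width (proj₁ a) ℕ.≤ width (proj₁ b) → ∀ i → side a i ℕ.≤ side b i
  side-mono _ _ wa≤wb zero             = wa≤wb
  side-mono _ _ _     (suc zero)       = ℕ.≤-refl
  side-mono _ _ _     (suc (suc zero)) = ℕ.≤-refl

  φ-comparable : ∀ a b → Comparable 1ℚ (φ a) (φ b)
  φ-comparable a b with ℕ.≤-total (width (proj₁ a)) (width (proj₁ b))
  ... | inj₁ wa≤wb = inj₁ (ℕBox-⊑₁ (corner a) (side a) (corner b) (side b) (side-mono a b wa≤wb))
  ... | inj₂ wb≤wa = inj₂ (ℕBox-⊑₁ (corner b) (side b) (corner a) (side a) (side-mono b a wb≤wa))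

  φ-tame : Tame G 4 1ℚ φ
  φ-tame = thin-by-colouring G 4 {φ} colour colour-separates ,
           (λ v → box-convex (φ v) , ℕBox-shape (corner v) (side v) (side-positive v)) ,
           φ-comparable

lemma16 : (r t : ℕ) → HasTameBoxRep (T (suc r) ⊠ P (suc t)) 4 1ℚ
lemma16 r t = φ , φ-represents , φ-tame
  where open StarPathBoxes r t
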